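{- Let $G=(V,E)$ be a graph, let $\omega:E\to\mathbb{Q}$ be an edge-weight function, and let $k$ be an integer. Let $\chi$ and $\chi'$ be $(k-1)$-optimal $c$-colorings of $G$ and let $v\in V$ be a vertex whose distance in $G$ to each vertex of $D_{\mathrm{flip}}(\chi,\chi')$ is at least $k+1$. If there is no improving $k$-neighbor $\hat\chi$ of $\chi$ with $v\in D_{\mathrm{flip}}(\chi,\hat\chi)$, then there is no improving $k$-neighbor $\tilde\chi$ of $\chi'$ with $v\in D_{\mathrm{flip}}(\chi',\tilde\chi)$.
   Context: A $c$-coloring is a map $V\to\{1,\dots,c\}$. $D_{\mathrm{flip}}(\chi,\chi')=\{u:\chi(u)\neq\chi'(u)\}$, $d_{\mathrm{flip}}=|D_{\mathrm{flip}}|$, $E(\chi)=\{\{u,w\}\in E:\chi(u)\neq\chi(w)\}$, and $\omega(F)$ is the total weight of $F$. A coloring $\chi'$ is an improving $k$-neighbor of $\chi$ if $d_{\mathrm{flip}}(\chi,\chi')\le k$ and $\omega(E(\chi'))>\omega(E(\chi))$. A coloring is $k$-optimal if it has no improving $k$-neighbor. -}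

module Defs where

open import Data.Nat using (ℕ; zero; suc; _≤_; _∸_)
open import Data.Fin using (Fin; toℕ)
open import Data.Fin.Properties using (_≟_)
open import Data.Bool using (Bool; true; false; if_then_else_; _∧_; not)
open import Data.List using (List; foldr; filter; length)
open import Data.List using () renaming (map to lmap)
open import Data.Fin.Base using () renaming (_<_ to _<ᶠ_)
open import Data.List.Base using ()
open import Data.Product using (Σ; _×_; _,_; ∃-syntax)
open import Data.Rational using (ℚ; 0ℚ; _+_; _<_)
open import Relation.Binary.PropositionalEquality using (_≡_; _≢_)
open import Relation.Nullary using (¬_; does)
open import Relation.Nullary.Decidable using (¬?)
open import Data.List.Base using (allFin)
open import Data.Nat.Properties using (_<?_)

record Graph (n : ℕ) : Set where
  field
    Adj   : Fin n → Fin n → Bool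
    sym   : ∀ u w → Adj u w ≡ Adj w u
    irrfl : ∀ u → Adj u u ≡ false
open Graph public

-- Edge weights ω : E → ℚ, given as a function on vertex pairs; only the
-- value ω u w with toℕ u < toℕ w and u,w adjacent is ever used, so each
-- edge {u,w} carries exactly one weight.
Weight : ℕ → Set
Weight n = Fin n → Fin n → ℚ

Coloring : ℕ → ℕ → Set
Coloring n c = Fin n → Fin c

sumℚ : List ℚ → ℚ
sumℚ = foldr _+_ 0ℚ

module _ {n c : ℕ} where

  InDflip : Coloring n c → Coloring n c → Fin n → Set
  InDflip χ χ' u = χ u ≢ χ' u

  dflip : Coloring n c → Coloring n c → ℕ
  dflip χ χ' = length (filter (λ u → ¬? (χ u ≟ χ' u)) (allFin n))

  cutWeight : Graph n → Weight n → Coloring n c → ℚ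
  cutWeight G ω χ =
    sumℚ (lmap (λ u → sumℚ (lmap (λ w →
      if does (toℕ u <? toℕ w) ∧ Adj G u w ∧ not (does (χ u ≟ χ w))
      then ω u w else 0ℚ) (allFin n))) (allFin n))

  ImprovingNeighbor : Graph n → Weight n → ℕ → Coloring n c → Coloring n c → Set
  ImprovingNeighbor G ω k χ χ' =
    dflip χ χ' ≤ k × cutWeight G ω χ < cutWeight G ω χ'

  Optimal : Graph n → Weight n → ℕ → Coloring n c → Set
  Optimal G ω k χ = ∀ (χ' : Coloring n c) → ¬ ImprovingNeighbor G ω k χ χ'

data Walk {n : ℕ} (G : Graph n) : Fin n → Fin n → ℕ → Set where
  here : ∀ u → Walk G u u zero
  step : ∀ {u x w m} → Adj G u x ≡ true → Walk G x w m → Walk G u w (suc m)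

-- dist_G(u,w) ≥ d  (distance = least walk length; ∞ if unreachable)
DistAtLeast : {n : ℕ} → Graph n → Fin n → Fin n → ℕ → Set
DistAtLeast G u w d = ∀ m → Walk G u w m → d ≤ m

-- Let ψ be an improving k-neighbour of χ' flipping v, and let R be the connected
-- component of v in the subgraph induced by D_flip(χ', ψ).  Since that set has at
-- most k vertices, R lies within distance k - 1 of v, so χ and χ' agree on R and on
-- all its neighbours.  No edge joins R to the rest of D_flip(χ', ψ), so the cut gain
-- of ψ over χ' splits into the gain of flipping R and the gain of flipping the rest;
-- the latter is a (k-1)-neighbour of χ', hence not improving, so flipping R alone
-- improves χ'.  As χ looks like χ' around R, flipping R (to ψ's colours) improves χ
-- by the same amount, and it flips v.
module Submission where

open import Defs hiding (sym)
open import Level using (0ℓ)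
open import Data.Nat as ℕ using (ℕ; zero; suc; _∸_; z≤n; s≤s)
import Data.Nat.Properties as ℕ
open import Data.Fin using (Fin; toℕ)
open import Data.Fin.Properties using (_≟_; any?)
open import Data.Bool using (true; false; if_then_else_; _∧_; not)
import Data.Bool.Properties as Bool
open import Data.List using ([]; _∷_; filter; length; allFin; map)
open import Data.List.Properties using (map-cong)
open import Data.List.Membership.Propositional using (_∈_)
open import Data.List.Membership.Propositional.Properties using (∈-allFin)
open import Data.List.Relation.Unary.Any using (here; there)
open import Data.Product using (Σ; _×_; _,_; ∃-syntax)
open import Data.Sum using (_⊎_; inj₁; inj₂)
open import Function using (flip; _∘_)
open import Data.Rational using (ℚ; 0ℚ; _+_; _<_; _≤_)
import Data.Rational.Properties as ℚ
open import Algebra.Bundles using (CommutativeMonoid)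
open import Algebra.Properties.CommutativeSemigroup
  (CommutativeMonoid.commutativeSemigroup ℚ.+-0-commutativeMonoid) using (interchange)
open import Relation.Binary.PropositionalEquality
  using (_≡_; refl; sym; trans; cong; cong₂; _≗_; module ≡-Reasoning)
open import Relation.Nullary using (¬_; Dec; yes; no; does; contradiction)
open import Relation.Nullary.Decidable using (¬?; _×-dec_; _⊎-dec_; decidable-stable)
open import Relation.Unary using (Pred; Decidable; _⊆_)
open import Relation.Unary.Properties using (∅?)

module _ {A : Set} {P Q : Pred A 0ℓ} (P? : Decidable P) (Q? : Decidable Q) (P⊆Q : P ⊆ Q) where

  length-filter-mono : ∀ xs → length (filter P? xs) ℕ.≤ length (filter Q? xs)
  length-filter-mono [] = z≤n
  length-filter-mono (x ∷ xs) with P? x | Q? x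
  ... | yes _  | yes _  = s≤s (length-filter-mono xs)
  ... | yes px | no ¬qx = contradiction (P⊆Q px) ¬qx
  ... | no _   | yes _  = ℕ.m≤n⇒m≤1+n (length-filter-mono xs)
  ... | no _   | no _   = length-filter-mono xs

  length-filter-< : ∀ {y} xs → y ∈ xs → Q y → ¬ P y →
                    length (filter P? xs) ℕ.< length (filter Q? xs)
  length-filter-< (x ∷ xs) (here refl) qy ¬py with P? x | Q? x
  ... | yes py | _      = contradiction py ¬py
  ... | no _   | yes _  = s≤s (length-filter-mono xs)
  ... | no _   | no ¬qy = contradiction qy ¬qy
  length-filter-< (x ∷ xs) (there y∈xs) qy ¬py with P? x | Q? x
  ... | yes _  | yes _  = s≤s (length-filter-< xs y∈xs qy ¬py)
  ... | yes px | no ¬qx = contradiction (P⊆Q px) ¬qx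
  ... | no _   | yes _  = ℕ.m≤n⇒m≤1+n (length-filter-< xs y∈xs qy ¬py)
  ... | no _   | no _   = length-filter-< xs y∈xs qy ¬py

sumℚ-map-+ : ∀ {A : Set} (f g : A → ℚ) xs →
             sumℚ (map f xs) + sumℚ (map g xs) ≡ sumℚ (map (λ x → f x + g x) xs)
sumℚ-map-+ f g [] = ℚ.+-identityʳ 0ℚ
sumℚ-map-+ f g (x ∷ xs) =
  trans (interchange (f x) _ (g x) _) (cong (f x + g x +_) (sumℚ-map-+ f g xs))

sumℚ-map-exchange : ∀ {A : Set} {f g f' g' : A → ℚ} →
  (∀ x → f x + g x ≡ f' x + g' x) →
  ∀ xs → sumℚ (map f xs) + sumℚ (map g xs) ≡ sumℚ (map f' xs) + sumℚ (map g' xs)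
sumℚ-map-exchange {f = f} {g} {f'} {g'} pointwise xs = begin
  sumℚ (map f xs) + sumℚ (map g xs)    ≡⟨ sumℚ-map-+ f g xs ⟩
  sumℚ (map (λ x → f x + g x) xs)      ≡⟨ cong sumℚ (map-cong pointwise xs) ⟩
  sumℚ (map (λ x → f' x + g' x) xs)    ≡⟨ sumℚ-map-+ f' g' xs ⟨
  sumℚ (map f' xs) + sumℚ (map g' xs)  ∎
  where open ≡-Reasoning

+-cancelʳ-< : ∀ {p q} r → p + r < q + r → p < q
+-cancelʳ-< {p} {q} r p+r<q+r with p ℚ.<? q
... | yes p<q = p<q
... | no p≮q  =
  contradiction (ℚ.<-≤-trans p+r<q+r (ℚ.+-monoˡ-≤ r (ℚ.≮⇒≥ p≮q))) (ℚ.<-irrefl refl)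

Walk-snoc : ∀ {n} {G : Graph n} {u w x m} →
            Walk G u w m → Adj G w x ≡ true → Walk G u x (suc m)
Walk-snoc (here _)   adj = step adj (here _)
Walk-snoc (step e p) adj = step e (Walk-snoc p adj)

Adj-sym : ∀ {n} (G : Graph n) {u w} → Adj G u w ≡ true → Adj G w u ≡ true
Adj-sym G {u} {w} = trans (Graph.sym G w u)

-- What the proof needs of the component of v in G[S].
record Component {n : ℕ} (G : Graph n) (S : Pred (Fin n) 0ℓ) (v : Fin n) (k : ℕ) :
                 Set₁ where
  field
    Member  : Pred (Fin n) 0ℓ
    member? : Decidable Member
    root    : Member v
    closed  : ∀ {u w} → Member u → Adj G u w ≡ true → S w → Member w
    radius  : ∀ {u} → Member u → ∃[ m ] m ℕ.< k × Walk G v u m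

module BreadthFirst {n : ℕ} (G : Graph n) {S : Pred (Fin n) 0ℓ} (S? : Decidable S) (v : Fin n)
  where

  Layer : ℕ → Pred (Fin n) 0ℓ
  Layer zero    u = u ≡ v
  Layer (suc j) u = Layer j u ⊎ (S u × ∃[ w ] Layer j w × Adj G w u ≡ true)

  layer? : ∀ j → Decidable (Layer j)
  layer? zero    u = u ≟ v
  layer? (suc j) u =
    layer? j u ⊎-dec (S? u ×-dec any? (λ w → layer? j w ×-dec (Adj G w u Bool.≟ true)))

  layer-root : ∀ j → Layer j v
  layer-root zero    = refl
  layer-root (suc j) = inj₁ (layer-root j)

  layer-walk : ∀ j {u} → Layer j u → ∃[ m ] m ℕ.≤ j × Walk G v u m
  layer-walk zero    refl = 0 , z≤n , here v
  layer-walk (suc j) (inj₁ old) with layer-walk j old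
  ... | m , m≤j , p = m , ℕ.m≤n⇒m≤1+n m≤j , p
  layer-walk (suc j) (inj₂ (_ , w , old , adj)) with layer-walk j old
  ... | m , m≤j , p = suc m , s≤s m≤j , Walk-snoc p adj

  layer⊆S : S v → ∀ j → Layer j ⊆ S
  layer⊆S Sv zero    refl               = Sv
  layer⊆S Sv (suc j) (inj₁ old)         = layer⊆S Sv j old
  layer⊆S Sv (suc j) (inj₂ (Su , _))    = Su

  size : ℕ → ℕ
  size j = length (filter (layer? j) (allFin n))

  Stable : ℕ → Set
  Stable j = Layer (suc j) ⊆ Layer j

  stable-or-grows : ∀ j → Stable j ⊎ size j ℕ.< size (suc j)
  stable-or-grows j with any? (λ u → layer? (suc j) u ×-dec ¬? (layer? j u))
  ... | yes (u , new , ¬old) =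
    inj₂ (length-filter-< (layer? j) (layer? (suc j)) inj₁ (allFin n) (∈-allFin u) new ¬old)
  ... | no none =
    inj₁ λ {u} new → decidable-stable (layer? j u) (λ ¬old → none (u , new , ¬old))

  stable-before-or-large : ∀ j → (∃[ i ] i ℕ.< j × Stable i) ⊎ j ℕ.< size j
  stable-before-or-large zero =
    inj₂ (ℕ.≤-trans (s≤s z≤n)
      (length-filter-< ∅? (layer? 0) (λ ()) (allFin n) (∈-allFin v) refl (λ ())))
  stable-before-or-large (suc j) with stable-before-or-large j
  ... | inj₁ (i , i<j , st) = inj₁ (i , ℕ.m<n⇒m<1+n i<j , st)
  ... | inj₂ j<size with stable-or-grows j
  ...   | inj₁ st   = inj₁ (j , ℕ.n<1+n j , st)
  ...   | inj₂ grow = inj₂ (ℕ.≤-trans (s≤s j<size) grow)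

  -- The layers lie in S and grow strictly until they stabilise, so with |S| ≤ k
  -- they stabilise at some step i < k.
  component : ∀ {k} → S v → length (filter S? (allFin n)) ℕ.≤ k → Component G S v k
  component {k} Sv |S|≤k with stable-before-or-large k
  ... | inj₂ k<size = contradiction (ℕ.<-≤-trans k<size size≤k) (ℕ.<-irrefl refl)
    where
    size≤k : size k ℕ.≤ k
    size≤k = ℕ.≤-trans (length-filter-mono (layer? k) S? (layer⊆S Sv k) (allFin n)) |S|≤k
  ... | inj₁ (i , i<k , st) = record
    { Member  = Layer i
    ; member? = layer? i
    ; root    = layer-root i
    ; closed  = λ {u} {w} old adj Sw → st (inj₂ (Sw , u , old , adj))
    ; radius  = λ old → let m , m≤i , p = layer-walk i old in m , ℕ.≤-<-trans m≤i i<k , p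
    }

module _ {n c : ℕ} {a a' b b' : Coloring n c} (flips⊆ : InDflip a a' ⊆ InDflip b b') where

  dflip-mono : dflip a a' ℕ.≤ dflip b b'
  dflip-mono =
    length-filter-mono (λ u → ¬? (a u ≟ a' u)) (λ u → ¬? (b u ≟ b' u)) flips⊆ (allFin n)

  dflip-< : ∀ {v} → InDflip b b' v → ¬ InDflip a a' v → dflip a a' ℕ.< dflip b b'
  dflip-< {v} bv≢b'v ¬av≢a'v =
    length-filter-< (λ u → ¬? (a u ≟ a' u)) (λ u → ¬? (b u ≟ b' u))
      flips⊆ (allFin n) (∈-allFin v) bv≢b'v ¬av≢a'v

module CutWeight {n c : ℕ} (G : Graph n) (ω : Weight n) where

  cut : Coloring n c → ℚ
  cut = cutWeight G ω

  edgeTerm : Coloring n c → Fin n → Fin n → ℚ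
  edgeTerm χ u w =
    if does (toℕ u ℕ.<? toℕ w) ∧ Adj G u w ∧ not (does (χ u ≟ χ w))
    then ω u w else 0ℚ

  edgeTerm-cong : ∀ {a b u w} → a u ≡ b u → a w ≡ b w →
                  edgeTerm a u w ≡ edgeTerm b u w
  edgeTerm-cong {u = u} {w} = cong₂ λ s t →
    if does (toℕ u ℕ.<? toℕ w) ∧ Adj G u w ∧ not (does (s ≟ t)) then ω u w else 0ℚ

  edgeTerm-nonadjacent : ∀ {a u w} → Adj G u w ≡ false → edgeTerm a u w ≡ 0ℚ
  edgeTerm-nonadjacent {u = u} {w} ¬adj rewrite ¬adj =
    cong (λ b → if b then ω u w else 0ℚ) (Bool.∧-zeroʳ (does (toℕ u ℕ.<? toℕ w)))

  cut-cong : ∀ {a b} → a ≗ b → cut a ≡ cut b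
  cut-cong a≗b = cong sumℚ (map-cong (λ u →
    cong sumℚ (map-cong (λ w → edgeTerm-cong (a≗b u) (a≗b w)) (allFin n))) (allFin n))

  AgreeAt : Coloring n c → Coloring n c → Fin n → Fin n → Set
  AgreeAt a b u w = a u ≡ b u × a w ≡ b w

  edgeTerm-exchange : ∀ {a b a' b' u w} →
    (AgreeAt a a' u w × AgreeAt b b' u w) ⊎ (AgreeAt a b' u w × AgreeAt b a' u w) ⊎
    Adj G u w ≡ false →
    edgeTerm a u w + edgeTerm b u w ≡ edgeTerm a' u w + edgeTerm b' u w
  edgeTerm-exchange {a} {b} {a'} {b'} {u} {w} (inj₁ ((au , aw) , (bu , bw))) =
    cong₂ _+_ (edgeTerm-cong {a} {a'} au aw) (edgeTerm-cong {b} {b'} bu bw)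
  edgeTerm-exchange {a} {b} {a'} {b'} {u} {w} (inj₂ (inj₁ ((au , aw) , (bu , bw)))) =
    trans (cong₂ _+_ (edgeTerm-cong {a} {b'} au aw) (edgeTerm-cong {b} {a'} bu bw))
      (ℚ.+-comm (edgeTerm b' u w) (edgeTerm a' u w))
  edgeTerm-exchange {a} {b} {a'} {b'} {u} {w} (inj₂ (inj₂ ¬adj)) = cong₂ _+_
    (trans (edgeTerm-nonadjacent {a} ¬adj) (sym (edgeTerm-nonadjacent {a'} ¬adj)))
    (trans (edgeTerm-nonadjacent {b} ¬adj) (sym (edgeTerm-nonadjacent {b'} ¬adj)))

  cut-exchange : ∀ {a b a' b'} →
    (∀ u w → edgeTerm a u w + edgeTerm b u w ≡ edgeTerm a' u w + edgeTerm b' u w) →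
    cut a + cut b ≡ cut a' + cut b'
  cut-exchange edge =
    sumℚ-map-exchange (λ u → sumℚ-map-exchange (edge u) (allFin n)) (allFin n)

  module Splice {R : Pred (Fin n) 0ℓ} (R? : Decidable R) where

    -- Opaque, so that unifying splice a b with splice a' b' solves a = a' and b = b'.
    opaque
      splice : Coloring n c → Coloring n c → Coloring n c
      splice a b u = if does (R? u) then a u else b u

      splice-in : ∀ {a b u} → R u → splice a b u ≡ a u
      splice-in {u = u} Ru with R? u
      ... | yes _  = refl
      ... | no ¬Ru = contradiction Ru ¬Ru

      splice-congˡ : ∀ {a a' b u} → (R u → a u ≡ a' u) →
                     splice a b u ≡ splice a' b u
      splice-congˡ {u = u} eq with R? u
      ... | yes Ru = eq Ru
      ... | no _   = refl

      splice-congʳ : ∀ {a b b' u} → (¬ R u → b u ≡ b' u) →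
                     splice a b u ≡ splice a b' u
      splice-congʳ {u = u} eq with R? u
      ... | yes _   = refl
      ... | no ¬Ru  = eq ¬Ru

      splice-self : ∀ {a} → splice a a ≗ a
      splice-self u with R? u
      ... | yes _ = refl
      ... | no _  = refl

      splice-flips⊆ : ∀ {a b} → InDflip a (splice a b) ⊆ InDflip a b
      splice-flips⊆ {x = u} a≢splice a≡b with R? u
      ... | yes _ = a≢splice refl
      ... | no _  = a≢splice a≡b

      splice-flips⊆-agreeing : ∀ {a b y} → (∀ {u} → R u → a u ≡ b u) →
                               InDflip a (splice y a) ⊆ InDflip b y
      splice-flips⊆-agreeing a≐b {u} a≢splice b≡y with R? u
      ... | yes Ru = a≢splice (trans (a≐b Ru) b≡y)
      ... | no _   = a≢splice refl

    AgreeOnBoundary : Coloring n c → Coloring n c → Set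
    AgreeOnBoundary a b = ∀ {u w} → R u → ¬ R w → Adj G u w ≡ true → a w ≡ b w

    cut-splice-exchange : ∀ {p q r s} → AgreeOnBoundary q s →
      cut (splice p q) + cut (splice r s) ≡ cut (splice p s) + cut (splice r q)
    cut-splice-exchange {p} {q} {r} {s} q≐s =
      cut-exchange {splice p q} {splice r s} {splice p s} {splice r q} edge
      where
      straight : ∀ {u w} → (¬ R u → q u ≡ s u) → (¬ R w → q w ≡ s w) →
        AgreeAt (splice p q) (splice p s) u w × AgreeAt (splice r s) (splice r q) u w
      straight qu≡su qw≡sw =
        (splice-congʳ qu≡su , splice-congʳ qw≡sw) ,
        (sym (splice-congʳ qu≡su) , sym (splice-congʳ qw≡sw))

      crossed : ∀ {u w} → ¬ R u → ¬ R w →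
        AgreeAt (splice p q) (splice r q) u w × AgreeAt (splice r s) (splice p s) u w
      crossed ¬Ru ¬Rw =
        (splice-congˡ (flip contradiction ¬Ru) , splice-congˡ (flip contradiction ¬Rw)) ,
        (splice-congˡ (flip contradiction ¬Ru) , splice-congˡ (flip contradiction ¬Rw))

      agreement : ∀ {u w} → Dec (Adj G u w ≡ true) → Dec (R u) → Dec (R w) →
        (AgreeAt (splice p q) (splice p s) u w × AgreeAt (splice r s) (splice r q) u w) ⊎
        (AgreeAt (splice p q) (splice r q) u w × AgreeAt (splice r s) (splice p s) u w) ⊎
        Adj G u w ≡ false
      agreement (no ¬adj) _        _        = inj₂ (inj₂ (Bool.¬-not ¬adj))
      agreement (yes adj) (yes Ru) _        =
        inj₁ (straight (contradiction Ru) (λ ¬Rw → q≐s Ru ¬Rw adj))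
      agreement (yes adj) (no ¬Ru) (yes Rw) =
        inj₁ (straight (λ ¬Ru → q≐s Rw ¬Ru (Adj-sym G adj)) (contradiction Rw))
      agreement (yes _)   (no ¬Ru) (no ¬Rw) = inj₂ (inj₁ (crossed ¬Ru ¬Rw))

      edge : ∀ u w → edgeTerm (splice p q) u w + edgeTerm (splice r s) u w
                   ≡ edgeTerm (splice p s) u w + edgeTerm (splice r q) u w
      edge u w = edgeTerm-exchange {splice p q} {splice r s} {splice p s} {splice r q}
                   (agreement (Adj G u w Bool.≟ true) (R? u) (R? w))

    splice-improves : ∀ {k x y v} →
                      Optimal G ω (k ∸ 1) x → ImprovingNeighbor G ω k x y →
                      R v → InDflip x y v → AgreeOnBoundary y x → cut x < cut (splice y x)
    splice-improves {k} {x} {y} {v} opt (dxy≤k , x<y) Rv xv≢yv y≐x =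
      +-cancelʳ-< (cut (splice x y)) (begin-strict
        cut x + cut (splice x y)             ≤⟨ ℚ.+-monoʳ-≤ (cut x) rest-not-improving ⟩
        cut x + cut x                        <⟨ ℚ.+-monoˡ-< (cut x) x<y ⟩
        cut y + cut x                        ≡⟨ split ⟩
        cut (splice y x) + cut (splice x y)  ∎)
      where
      open ℚ.≤-Reasoning

      split : cut y + cut x ≡ cut (splice y x) + cut (splice x y)
      split = trans (sym (cong₂ _+_ (cut-cong splice-self) (cut-cong splice-self)))
                    (cut-splice-exchange y≐x)

      fewer-flips : dflip x (splice x y) ℕ.< dflip x y
      fewer-flips = dflip-< {a = x} {splice x y} {x} {y} splice-flips⊆ xv≢yv
        (λ xv≢splice → xv≢splice (sym (splice-in Rv)))

      rest-not-improving : cut (splice x y) ≤ cut x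
      rest-not-improving = ℚ.≮⇒≥ λ gain →
        opt (splice x y) (ℕ.∸-monoˡ-≤ 1 (ℕ.≤-trans fewer-flips dxy≤k) , gain)

    splice-transfers-gain : ∀ {a b y} →
                            (∀ {u} → R u → a u ≡ b u) → AgreeOnBoundary a b →
                            cut b < cut (splice y b) → cut a < cut (splice y a)
    splice-transfers-gain {a} {b} {y} a≐b a≐b-around b<splice =
      +-cancelʳ-< (cut b) (begin-strict
        cut a + cut b             <⟨ ℚ.+-monoʳ-< (cut a) b<splice ⟩
        cut a + cut (splice y b)  ≡⟨ ℚ.+-comm (cut a) _ ⟩
        cut (splice y b) + cut a  ≡⟨ transfer ⟨
        cut (splice y a) + cut b  ∎)
      where
      open ℚ.≤-Reasoning

      splice-b-a≗a : splice b a ≗ a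
      splice-b-a≗a u = trans (splice-congˡ (λ Ru → sym (a≐b Ru))) (splice-self u)

      transfer : cut (splice y a) + cut b ≡ cut (splice y b) + cut a
      transfer = begin-equality
        cut (splice y a) + cut b
          ≡⟨ cong (cut (splice y a) +_) (cut-cong splice-self) ⟨
        cut (splice y a) + cut (splice b b)
          ≡⟨ cut-splice-exchange a≐b-around ⟩
        cut (splice y b) + cut (splice b a)
          ≡⟨ cong (cut (splice y b) +_) (cut-cong splice-b-a≗a) ⟩
        cut (splice y b) + cut a
          ∎

lemma4 : {n c : ℕ} (G : Graph n) (ω : Weight n) (k : ℕ)
    (χ χ' : Coloring n c) →
    Optimal G ω (k ∸ 1) χ → Optimal G ω (k ∸ 1) χ' →
    (v : Fin n) →
    (∀ u → InDflip χ χ' u → DistAtLeast G v u (suc k)) →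
    ¬ (Σ (Coloring n c) λ χ̂ → ImprovingNeighbor G ω k χ χ̂ × InDflip χ χ̂ v) →
    ¬ (Σ (Coloring n c) λ χ̃ → ImprovingNeighbor G ω k χ' χ̃ × InDflip χ' χ̃ v)
lemma4 G ω k χ χ' _ χ'-optimal v far no-χ̂ (ψ , (dflip≤k , χ'<ψ) , v-flipped) =
  no-χ̂ (splice ψ χ , (fewer-flips , gain) , v-flipped-in-χ)
  where
  open Component (BreadthFirst.component G (λ u → ¬? (χ' u ≟ ψ u)) v v-flipped dflip≤k)
  open CutWeight G ω
  open Splice member?

  near : ∀ {u m} → m ℕ.≤ k → Walk G v u m → χ u ≡ χ' u
  near {u} m≤k p = decidable-stable (χ u ≟ χ' u) λ χu≢χ'u →
    ℕ.n≮n k (ℕ.<-≤-trans (far u χu≢χ'u _ p) m≤k)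

  inside : ∀ {u} → Member u → χ u ≡ χ' u
  inside Ru = let _ , m<k , p = radius Ru in near (ℕ.<⇒≤ m<k) p

  χ≐χ' : AgreeOnBoundary χ χ'
  χ≐χ' Ru _ adj = let _ , m<k , p = radius Ru in near m<k (Walk-snoc p adj)

  ψ≐χ' : AgreeOnBoundary ψ χ'
  ψ≐χ' {w = w} Ru ¬Rw adj =
    decidable-stable (ψ w ≟ χ' w) λ ψw≢χ'w → ¬Rw (closed Ru adj (ψw≢χ'w ∘ sym))

  gain : cut χ < cut (splice ψ χ)
  gain = splice-transfers-gain inside χ≐χ'
    (splice-improves {x = χ'} {ψ} χ'-optimal (dflip≤k , χ'<ψ) root v-flipped ψ≐χ')

  fewer-flips : dflip χ (splice ψ χ) ℕ.≤ k
  fewer-flips = ℕ.≤-trans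
    (dflip-mono {a = χ} {splice ψ χ} {χ'} {ψ} (splice-flips⊆-agreeing inside)) dflip≤k

  v-flipped-in-χ : InDflip χ (splice ψ χ) v
  v-flipped-in-χ χv≡ψv =
    v-flipped (trans (sym (inside root)) (trans χv≡ψv (splice-in root)))
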